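{- Let $G$ be a forest in which every vertex has threshold at least $2$. Then any nonempty set of $k$ seeds in $G$ activates fewer than $k$ additional vertices.
   Context: Bootstrap percolation: each vertex $v$ has a threshold $t(v)$; from an initially active seed set $A_0$, set $A_i=A_{i-1}\cup\{v:|N(v)\cap A_{i-1}|\ge t(v)\}$; the activated vertices are $\bigcup_iA_i$, and the additional ones are those not in $A_0$. -}

module Defs where

open import Data.Nat using (ℕ; zero; suc; _≤_; _<_; _≤ᵇ_)
open import Data.Fin using (Fin)
open import Data.Fin.Subset using (Subset; _∈_; _∉_; ∣_∣)
open import Data.Bool using (Bool; true; false; _∧_; _∨_; T)
open import Data.Vec using (tabulate; lookup)
open import Data.List using (List; []; _∷_; length)
open import Data.List.Relation.Unary.Unique.Propositional using (Unique)
open import Data.Product using (Σ; _×_; ∃)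
open import Relation.Binary.PropositionalEquality using (_≡_)
open import Relation.Nullary using (¬_)

record Graph (n : ℕ) : Set where
  field
    adj   : Fin n → Fin n → Bool
    sym   : ∀ u v → adj u v ≡ adj v u
    irrefl : ∀ v → adj v v ≡ false

open Graph public

Adj : ∀ {n} → Graph n → Fin n → Fin n → Set
Adj G u v = T (adj G u v)

data WalkFrom {n : ℕ} (G : Graph n) : Fin n → List (Fin n) → Fin n → Set where
  stop : ∀ v → WalkFrom G v [] v
  step : ∀ {u v w ws} → Adj G u v → WalkFrom G v ws w → WalkFrom G u (v ∷ ws) w

-- A cycle: distinct vertices v₀ v₁ … v_{m-1} with m ≥ 3, v_i ~ v_{i+1}, v_{m-1} ~ v₀.
record Cycle {n : ℕ} (G : Graph n) : Set where
  field
    start : Fin n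
    rest  : List (Fin n)
    end   : Fin n
    long  : 2 ≤ length rest
    walk  : WalkFrom G start rest end
    close : Adj G end start
    dist  : Unique (start ∷ rest)

Forest : ∀ {n} → Graph n → Set
Forest G = ¬ Cycle G

nbrCount : ∀ {n} → Graph n → Subset n → Fin n → ℕ
nbrCount G A v = ∣ tabulate (λ u → adj G v u ∧ lookup A u) ∣

stepSet : ∀ {n} → Graph n → (Fin n → ℕ) → Subset n → Subset n
stepSet G t A = tabulate (λ v → lookup A v ∨ (t v ≤ᵇ nbrCount G A v))

stage : ∀ {n} → Graph n → (Fin n → ℕ) → Subset n → ℕ → Subset n
stage G t A₀ zero    = A₀
stage G t A₀ (suc i) = stepSet G t (stage G t A₀ i)

Activated : ∀ {n} → Graph n → (Fin n → ℕ) → Subset n → Fin n → Set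
Activated G t A₀ v = ∃ λ i → v ∈ stage G t A₀ i

Additional : ∀ {n} → Graph n → (Fin n → ℕ) → Subset n → Fin n → Set
Additional G t A₀ v = Activated G t A₀ v × v ∉ A₀

-- Let I be a stage by which every listed vertex is active, S = A_I, and orient each
-- edge inside S from the endpoint activated earlier to the one activated later.  An
-- additional vertex v had at least t(v) ≥ 2 active neighbours when it became active,
-- all activated earlier, so it has in-degree at least 2 and S carries at least
-- 2 |S ∖ A₀| arcs.  As G[S] is a forest it has at most |S| - 1 ≤ k + |S ∖ A₀| - 1
-- edges, whence |S ∖ A₀| < k.  The edge bound is proved by deleting leaves; a leaf
-- exists because a walk in a graph of minimum degree 2 can be extended until it
-- closes a cycle.

{-# OPTIONS --safe #-}
module Submission where

open import Defs hiding (sym)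
open import Data.Nat using (ℕ; zero; suc; _+_; _∸_; _≤_; _<_; _<ᵇ_; _≤?_; _≤ᵇ_; _⊔_; z≤n; s≤s; s≤s⁻¹)
open import Data.Nat.Properties
  using ( ≤-refl; ≤-reflexive; ≤-trans; ≤-total; <⇒≤; <⇒≱; ≰⇒>; <-asym; n≤1+n; m≤n⇒m≤1+n
        ; m≤n⇒m<n∨m≡n; m≤m⊔n; m≤n⊔m; <ᵇ⇒<; <⇒<ᵇ; ≤ᵇ⇒≤; +-identityʳ; +-suc; +-assoc
        ; +-mono-≤; +-monoˡ-≤; +-monoʳ-≤; +-mono-<-≤; +-mono-≤-<; +-cancelʳ-≤; ∸-monoˡ-≤
        ; +-commutativeSemigroup; +-0-commutativeMonoid; module ≤-Reasoning )
open import Data.Bool using (Bool; true; false; _∧_; _∨_; not; if_then_else_; T)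
import Data.Bool.Properties as Bool
open import Data.Fin using (Fin; zero; suc; toℕ; fromℕ<)
open import Data.Fin.Properties using (_≟_; any?; toℕ-fromℕ<)
open import Data.Fin.Subset using (Subset; ∣_∣; _∉_)
open import Data.Vec using ([]; _∷_; lookup; tabulate)
open import Data.Vec.Properties using (lookup∘tabulate; []=⇒lookup; lookup⇒[]=)
open import Data.List using (List; []; _∷_; length; _++_)
open import Data.List.Relation.Unary.All as All using (All; []; _∷_)
open import Data.List.Relation.Unary.All.Properties using (¬Any⇒All¬; ++⁻ˡ)
open import Data.List.Relation.Unary.Any using (here; there) renaming (any? to any?ˡ)
open import Data.List.Relation.Unary.AllPairs using ([]; _∷_)
open import Data.List.Relation.Unary.Unique.Propositional using (Unique)
open import Data.List.Membership.Propositional using (_∈_)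
open import Data.Product using (∃; _×_; _,_; proj₁; proj₂)
open import Data.Sum using (inj₁; inj₂)
open import Data.Empty using (⊥-elim)
open import Function using (_∘_; id; Equivalence)
open import Relation.Nullary using (yes; no; does; contradiction; ¬?; _×-dec_; T?)
open import Relation.Nullary.Decidable using (dec-true; dec-false)
open import Relation.Binary.PropositionalEquality using (_≡_; _≢_; refl; sym; trans; cong; subst)
open import Algebra.Properties.CommutativeSemigroup +-commutativeSemigroup using (x∙yz≈y∙xz)
open import Algebra.Properties.CommutativeMonoid.Sum +-0-commutativeMonoid
  using (sum; sum-cong-≗; ∑-distrib-+; sum-replicate-zero)

𝟙 : Bool → ℕ
𝟙 b = if b then 1 else 0

𝟙≤1 : ∀ b → 𝟙 b ≤ 1
𝟙≤1 true  = ≤-refl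
𝟙≤1 false = z≤n

sum-mono-≤ : ∀ {m} {f g : Fin m → ℕ} → (∀ i → f i ≤ g i) → sum f ≤ sum g
sum-mono-≤ {zero}  f≤g = z≤n
sum-mono-≤ {suc m} f≤g = +-mono-≤ (f≤g zero) (sum-mono-≤ (f≤g ∘ suc))

sum-mono-< : ∀ {m} {f g : Fin m → ℕ} (i : Fin m) → (∀ j → f j ≤ g j) → f i < g i → sum f < sum g
sum-mono-< zero    f≤g fi<gi = +-mono-<-≤ fi<gi (sum-mono-≤ (f≤g ∘ suc))
sum-mono-< (suc i) f≤g fi<gi = +-mono-≤-< (f≤g zero) (sum-mono-< i (f≤g ∘ suc) fi<gi)

sum-zero : ∀ {m} {f : Fin m → ℕ} → (∀ i → f i ≡ 0) → sum f ≡ 0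
sum-zero {m} f≡0 = trans (sum-cong-≗ f≡0) (sum-replicate-zero m)

sum-pick : ∀ {m} (f : Fin m → ℕ) (i : Fin m) →
           sum f ≡ f i + sum (λ j → if does (j ≟ i) then 0 else f j)
sum-pick f zero    = refl
sum-pick f (suc i) = trans (cong (f zero +_) (sum-pick (f ∘ suc) i)) (x∙yz≈y∙xz (f zero) (f (suc i)) _)

VertexSet : ℕ → Set
VertexSet n = Fin n → Bool

module _ {n : ℕ} where

  infixl 6 _─_
  infix 4 _⊆_

  _⊆_ : VertexSet n → VertexSet n → Set
  s ⊆ t = ∀ v → s v ≡ true → t v ≡ true

  _─_ : VertexSet n → VertexSet n → VertexSet n
  (s ─ t) v = not (t v) ∧ s v

  ⁅_⁆ : Fin n → VertexSet n
  ⁅ x ⁆ v = does (v ≟ x)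

  ─-intro : ∀ s t {v} → s v ≡ true → t v ≡ false → (s ─ t) v ≡ true
  ─-intro s t sv tv rewrite sv | tv = refl

  ─-elim : ∀ s t {v} → (s ─ t) v ≡ true → s v ≡ true × t v ≡ false
  ─-elim s t {v} _ with t v | s v
  ... | false | true = refl , refl

  ─-⊆ : ∀ s t → s ─ t ⊆ s
  ─-⊆ s t v = proj₁ ∘ ─-elim s t

  ∈-─⁅⁆ : ∀ s {x v} → s v ≡ true → v ≢ x → (s ─ ⁅ x ⁆) v ≡ true
  ∈-─⁅⁆ s {x} {v} sv v≢x = ─-intro s ⁅ x ⁆ sv (dec-false (v ≟ x) v≢x)

  ∈-─⁅⁆⁻ : ∀ s {x v} → (s ─ ⁅ x ⁆) v ≡ true → s v ≡ true × v ≢ x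
  ∈-─⁅⁆⁻ s {x} {v} v∈ with sv , v∉x ← ─-elim s ⁅ x ⁆ v∈ =
    sv , λ v≡x → Bool.not-¬ (dec-true (v ≟ x) v≡x) v∉x

  weight : VertexSet n → (Fin n → ℕ) → ℕ
  weight s f = sum (λ v → if s v then f v else 0)

  size : VertexSet n → ℕ
  size s = weight s (λ _ → 1)

  weight-cong : ∀ s {f g : Fin n → ℕ} → (∀ v → f v ≡ g v) → weight s f ≡ weight s g
  weight-cong s f≡g = sum-cong-≗ (λ v → cong (if s v then_else 0) (f≡g v))

  weight-+ : ∀ s (f g : Fin n → ℕ) → weight s (λ v → f v + g v) ≡ weight s f + weight s g
  weight-+ s f g =
    trans (sum-cong-≗ if-+) (∑-distrib-+ (λ v → if s v then f v else 0) (λ v → if s v then g v else 0))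
    where
    if-+ : ∀ v → (if s v then f v + g v else 0) ≡ (if s v then f v else 0) + (if s v then g v else 0)
    if-+ v with s v
    ... | true  = refl
    ... | false = refl

  weight-mono-≤ : ∀ s {t} {f g : Fin n → ℕ} → s ⊆ t → (∀ v → s v ≡ true → f v ≤ g v) →
                  weight s f ≤ weight t g
  weight-mono-≤ s {t} {f} {g} s⊆t f≤g = sum-mono-≤ pointwise
    where
    pointwise : ∀ v → (if s v then f v else 0) ≤ (if t v then g v else 0)
    pointwise v with s v in sv
    ... | false = z≤n
    ... | true rewrite s⊆t v sv = f≤g v sv

  weight-zero : ∀ s {f : Fin n → ℕ} → (∀ v → s v ≡ true → f v ≡ 0) → weight s f ≡ 0
  weight-zero s {f} f≡0 = sum-zero pointwise
    where
    pointwise : ∀ v → (if s v then f v else 0) ≡ 0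
    pointwise v with s v in sv
    ... | false = refl
    ... | true  = f≡0 v sv

  weight-remove : ∀ s (f : Fin n → ℕ) x → weight s f ≡ (if s x then f x else 0) + weight (s ─ ⁅ x ⁆) f
  weight-remove s f x = trans (sum-pick _ x) (cong (_ +_) (sum-cong-≗ pointwise))
    where
    pointwise : ∀ v → (if does (v ≟ x) then 0 else (if s v then f v else 0)) ≡
                      (if (s ─ ⁅ x ⁆) v then f v else 0)
    pointwise v with does (v ≟ x)
    ... | true  = refl
    ... | false = refl

  weight-remove-∈ : ∀ s {x} (f : Fin n → ℕ) → s x ≡ true → weight s f ≡ f x + weight (s ─ ⁅ x ⁆) f
  weight-remove-∈ s {x} f sx =
    trans (weight-remove s f x) (cong (λ b → (if b then f x else 0) + weight (s ─ ⁅ x ⁆) f) sx)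

  size-remove : ∀ s {x} → s x ≡ true → size s ≡ suc (size (s ─ ⁅ x ⁆))
  size-remove s = weight-remove-∈ s (λ _ → 1)

  size≤size+size─ : ∀ s t → size s ≤ size t + size (s ─ t)
  size≤size+size─ s t =
    ≤-trans (sum-mono-≤ pointwise) (≤-reflexive (∑-distrib-+ (𝟙 ∘ t) (𝟙 ∘ (s ─ t))))
    where
    pointwise : ∀ v → 𝟙 (s v) ≤ 𝟙 (t v) + 𝟙 ((s ─ t) v)
    pointwise v with s v | t v
    ... | false | _     = z≤n
    ... | true  | true  = ≤-refl
    ... | true  | false = ≤-refl

  length≤size : ∀ {s L} → Unique L → All (λ v → s v ≡ true) L → length L ≤ size s
  length≤size [] [] = z≤n
  length≤size {s} {x ∷ L} (x∉L ∷ uniq) (sx ∷ L⊆s) = begin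
    suc (length L)          ≤⟨ s≤s (length≤size uniq (All.zipWith in─x (x∉L , L⊆s))) ⟩
    suc (size (s ─ ⁅ x ⁆))  ≡⟨ size-remove s sx ⟨
    size s                  ∎
    where
    open ≤-Reasoning
    in─x : ∀ {v} → x ≢ v × s v ≡ true → (s ─ ⁅ x ⁆) v ≡ true
    in─x (x≢v , sv) = ∈-─⁅⁆ s sv (x≢v ∘ sym)

∣p∣≡size : ∀ {n} (p : Subset n) → ∣ p ∣ ≡ size (lookup p)
∣p∣≡size []          = refl
∣p∣≡size (true ∷ p)  = cong suc (∣p∣≡size p)
∣p∣≡size (false ∷ p) = ∣p∣≡size p

∧-true⁻ : ∀ {a b} → a ∧ b ≡ true → a ≡ true × b ≡ true
∧-true⁻ {true} {true} _ = refl , refl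

≡true⇒T : ∀ {b} → b ≡ true → T b
≡true⇒T = Equivalence.from Bool.T-≡

T⇒≡true : ∀ {b} → T b → b ≡ true
T⇒≡true = Equivalence.to Bool.T-≡

Unique-++⁻ˡ : ∀ {n} (xs : List (Fin n)) {ys} → Unique (xs ++ ys) → Unique xs
Unique-++⁻ˡ []       _            = []
Unique-++⁻ˡ (x ∷ xs) (x∉ ∷ uniq) = ++⁻ˡ xs x∉ ∷ Unique-++⁻ˡ xs uniq

module _ {n : ℕ} (G : Graph n) where

  Adj-sym : ∀ {u v} → Adj G u v → Adj G v u
  Adj-sym {u} {v} = subst T (Graph.sym G u v)

  walk-prefix : ∀ {u xs e w} → WalkFrom G u xs e → w ∈ xs →
                ∃ λ ys → ∃ λ zs → xs ≡ ys ++ zs × WalkFrom G u ys w × 1 ≤ length ys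
  walk-prefix {xs = v ∷ vs} (step u~v walk) (here refl) = v ∷ [] , vs , refl , step u~v (stop v) , s≤s z≤n
  walk-prefix {xs = v ∷ vs} (step u~v walk) (there w∈vs)
    with ys , zs , refl , walk-to-w , _ ← walk-prefix walk w∈vs =
    v ∷ ys , zs , refl , step u~v walk-to-w , s≤s z≤n

  close-cycle : ∀ {h p xs e w} → WalkFrom G h (p ∷ xs) e → Unique (h ∷ p ∷ xs) →
                w ∈ xs → Adj G h w → Cycle G
  close-cycle {h} {p} {w = w} (step h~p walk) uniq w∈xs h~w
    with ys , zs , refl , walk-to-w , 1≤ys ← walk-prefix walk w∈xs = record
    { start = h ; rest = p ∷ ys ; end = w ; long = s≤s 1≤ys
    ; walk = step h~p walk-to-w ; close = Adj-sym h~w ; dist = Unique-++⁻ˡ (h ∷ p ∷ ys) uniq }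

  degree : VertexSet n → Fin n → ℕ
  degree s x = weight s (λ u → 𝟙 (adj G x u))

  degree≤size─ : ∀ s x → degree s x ≤ size (s ─ ⁅ x ⁆)
  degree≤size─ s x = sum-mono-≤ pointwise
    where
    pointwise : ∀ v → (if s v then 𝟙 (adj G x v) else 0) ≤ (if (s ─ ⁅ x ⁆) v then 1 else 0)
    pointwise v with v ≟ x | s v
    ... | _        | false = z≤n
    ... | no _     | true  = 𝟙≤1 (adj G x v)
    ... | yes refl | true  = ≤-reflexive (cong 𝟙 (Graph.irrefl G x))

  module MinimumDegreeTwo (s : VertexSet n) (2≤degree : ∀ x → s x ≡ true → 2 ≤ degree s x) where

    other-neighbour : ∀ {h} → s h ≡ true → ∀ p → ∃ λ w → s w ≡ true × Adj G h w × w ≢ p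
    other-neighbour {h} sh p with any? (λ w → (s w Bool.≟ true) ×-dec (T? (adj G h w) ×-dec ¬? (w ≟ p)))
    ... | yes (w , sw , h~w , w≢p) = w , sw , h~w , w≢p
    ... | no none = contradiction (2≤degree h sh) (<⇒≱ (s≤s degree≤1))
      where
      only-p : ∀ v → (s ─ ⁅ p ⁆) v ≡ true → 𝟙 (adj G h v) ≡ 0
      only-p v v∈ with sv , v≢p ← ∈-─⁅⁆⁻ s v∈ | adj G h v in hv
      ... | false = refl
      ... | true  = contradiction (v , sv , ≡true⇒T hv , v≢p) none
      degree≤1 : degree s h ≤ 1
      degree≤1 = begin
        degree s h                                                 ≡⟨ weight-remove s _ p ⟩
        (if s p then 𝟙 (adj G h p) else 0) + degree (s ─ ⁅ p ⁆) h  ≡⟨ cong (_ +_) (weight-zero (s ─ ⁅ p ⁆) only-p) ⟩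
        (if s p then 𝟙 (adj G h p) else 0) + 0                     ≡⟨ +-identityʳ _ ⟩
        (if s p then 𝟙 (adj G h p) else 0)                         ≤⟨ at-most-one (s p) ⟩
        1                                                          ∎
        where
        open ≤-Reasoning
        at-most-one : ∀ b → (if b then 𝟙 (adj G h p) else 0) ≤ 1
        at-most-one true  = 𝟙≤1 (adj G h p)
        at-most-one false = z≤n

    -- Terminates because a path of distinct vertices of s has at most size s vertices.
    extend-path : ∀ fuel {h p xs e} → WalkFrom G h (p ∷ xs) e → Unique (h ∷ p ∷ xs) →
                  All (λ v → s v ≡ true) (h ∷ p ∷ xs) → size s < length (h ∷ p ∷ xs) + fuel →
                  Cycle G
    extend-path zero _ uniq on-s bound =
      contradiction (length≤size uniq on-s) (<⇒≱ (subst (size s <_) (+-identityʳ _) bound))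
    extend-path (suc fuel) {h} {p} {xs} walk uniq on-s@(sh ∷ _) bound
      with w , sw , h~w , w≢p ← other-neighbour sh p | any?ˡ (w ≟_) (h ∷ p ∷ xs)
    ... | no w∉path = extend-path fuel (step (Adj-sym h~w) walk) (¬Any⇒All¬ _ w∉path ∷ uniq) (sw ∷ on-s)
                                  (subst (size s <_) (+-suc _ fuel) bound)
    ... | yes (here refl)           = ⊥-elim (subst T (Graph.irrefl G h) h~w)
    ... | yes (there (here w≡p))    = contradiction w≡p w≢p
    ... | yes (there (there w∈xs)) = close-cycle walk uniq w∈xs h~w

    cycle : ∀ {x} → s x ≡ true → Cycle G
    cycle {x} sx with y , sy , x~y , y≢x ← other-neighbour sx x =
      extend-path (size s) (step (Adj-sym x~y) (stop x)) ((y≢x ∷ []) ∷ [] ∷ []) (sy ∷ sx ∷ [])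
                  (s≤s (n≤1+n _))

  forest⇒leaf : Forest G → ∀ {s x} → s x ≡ true → ∃ λ y → s y ≡ true × degree s y ≤ 1
  forest⇒leaf forest {s} sx with any? (λ y → (s y Bool.≟ true) ×-dec (degree s y ≤? 1))
  ... | yes (y , sy , degree≤1) = y , sy , degree≤1
  ... | no no-leaf = contradiction (MinimumDegreeTwo.cycle s 2≤degree sx) forest
    where
    2≤degree : ∀ y → s y ≡ true → 2 ≤ degree s y
    2≤degree y sy = ≰⇒> (λ degree≤1 → no-leaf (y , sy , degree≤1))

  module Ranked (r : Fin n → ℕ) where

    _⇝_ : Fin n → Fin n → Bool
    u ⇝ v = adj G u v ∧ (r u <ᵇ r v)

    indegree outdegree : VertexSet n → Fin n → ℕ
    indegree  s v = weight s (λ u → 𝟙 (u ⇝ v))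
    outdegree s u = weight s (λ v → 𝟙 (u ⇝ v))

    arcs : VertexSet n → ℕ
    arcs s = weight s (indegree s)

    indegree+outdegree≤degree : ∀ s x → indegree s x + outdegree s x ≤ degree s x
    indegree+outdegree≤degree s x =
      ≤-trans (≤-reflexive (sym (weight-+ s _ _))) (weight-mono-≤ s (λ _ → id) (λ u _ → one-direction u))
      where
      one-direction : ∀ u → 𝟙 (u ⇝ x) + 𝟙 (x ⇝ u) ≤ 𝟙 (adj G x u)
      one-direction u rewrite Graph.sym G u x with adj G x u | r u <ᵇ r x in ru<rx | r x <ᵇ r u in rx<ru
      ... | false | _     | _     = z≤n
      ... | true  | true  | true  =
        contradiction (<ᵇ⇒< (r u) (r x) (≡true⇒T ru<rx)) (<-asym (<ᵇ⇒< (r x) (r u) (≡true⇒T rx<ru)))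
      ... | true  | true  | false = ≤-refl
      ... | true  | false | true  = ≤-refl
      ... | true  | false | false = z≤n

    arcs-remove : ∀ {s x} → s x ≡ true → arcs s ≤ degree s x + arcs (s ─ ⁅ x ⁆)
    arcs-remove {s} {x} sx = begin
      arcs s                                            ≡⟨ weight-remove-∈ s (indegree s) sx ⟩
      indegree s x + weight s′ (indegree s)              ≡⟨ cong (indegree s x +_) split ⟩
      indegree s x + (outdegree s′ x + arcs s′)          ≡⟨ +-assoc (indegree s x) _ _ ⟨
      indegree s x + outdegree s′ x + arcs s′            ≤⟨ +-monoˡ-≤ (arcs s′) (+-monoʳ-≤ _ out-mono) ⟩
      indegree s x + outdegree s x + arcs s′             ≤⟨ +-monoˡ-≤ (arcs s′) (indegree+outdegree≤degree s x) ⟩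
      degree s x + arcs s′                               ∎
      where
      open ≤-Reasoning
      s′ : VertexSet n
      s′ = s ─ ⁅ x ⁆
      split : weight s′ (indegree s) ≡ outdegree s′ x + arcs s′
      split = trans (weight-cong s′ (λ v → weight-remove-∈ s (λ u → 𝟙 (u ⇝ v)) sx)) (weight-+ s′ _ _)
      out-mono : outdegree s′ x ≤ outdegree s x
      out-mono = weight-mono-≤ s′ (─-⊆ s ⁅ x ⁆) (λ _ _ → ≤-refl)

    arcs≤size∸1 : Forest G → ∀ s → arcs s ≤ size s ∸ 1
    arcs≤size∸1 forest s = go (suc (size s)) s ≤-refl
      where
      go : ∀ k s → size s < k → arcs s ≤ size s ∸ 1
      go (suc k) s size<1+k with any? (λ x → s x Bool.≟ true)
      ... | no s-empty = ≤-trans (≤-reflexive (weight-zero s λ v sv → contradiction (v , sv) s-empty)) z≤n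
      ... | yes (x , sx) with y , sy , degree≤1 ← forest⇒leaf forest sx = begin
        arcs s                           ≤⟨ arcs-remove sy ⟩
        degree s y + arcs (s ─ ⁅ y ⁆)    ≤⟨ leaf-bound degree≤1 (degree≤size─ s y) (go k (s ─ ⁅ y ⁆) size′<k) ⟩
        size (s ─ ⁅ y ⁆)                 ≡⟨ cong (_∸ 1) (size-remove s sy) ⟨
        size s ∸ 1                       ∎
        where
        open ≤-Reasoning
        size′<k : size (s ─ ⁅ y ⁆) < k
        size′<k = s≤s⁻¹ (subst (_< suc k) (size-remove s sy) size<1+k)
        leaf-bound : ∀ {a b c} → a ≤ 1 → a ≤ b → c ≤ b ∸ 1 → a + c ≤ b
        leaf-bound {b = zero}  _         z≤n z≤n = z≤n
        leaf-bound {b = suc b} z≤n       _   c≤b = m≤n⇒m≤1+n c≤b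
        leaf-bound {b = suc b} (s≤s z≤n) _   c≤b = s≤s c≤b

    indegree≥2⇒size─<size : Forest G → ∀ s a → (∀ v → (s ─ a) v ≡ true → 2 ≤ indegree s v) →
                            1 ≤ size a → size (s ─ a) < size a
    indegree≥2⇒size─<size forest s a 2≤indegree 1≤size-a = double≤pred⇒< 1≤size-a (begin
      size (s ─ a) + size (s ─ a)       ≡⟨ weight-+ (s ─ a) _ _ ⟨
      weight (s ─ a) (λ _ → 2)          ≤⟨ weight-mono-≤ (s ─ a) (─-⊆ s a) 2≤indegree ⟩
      arcs s                            ≤⟨ arcs≤size∸1 forest s ⟩
      size s ∸ 1                        ≤⟨ ∸-monoˡ-≤ 1 (size≤size+size─ s a) ⟩
      (size a + size (s ─ a)) ∸ 1       ∎)
      where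
      open ≤-Reasoning
      double≤pred⇒< : ∀ {k m} → 1 ≤ k → m + m ≤ (k + m) ∸ 1 → m < k
      double≤pred⇒< {suc k} {m} _ m+m≤k+m = s≤s (+-cancelʳ-≤ m m k m+m≤k+m)

∉⇒lookup≡false : ∀ {n} {p : Subset n} {x} → x ∉ p → lookup p x ≡ false
∉⇒lookup≡false {p = p} {x} x∉p = Bool.¬-not (x∉p ∘ lookup⇒[]= x p)

nbrCount≡size : ∀ {n} (G : Graph n) A v → nbrCount G A v ≡ size (λ u → adj G v u ∧ lookup A u)
nbrCount≡size G A v =
  trans (∣p∣≡size (tabulate neighbour)) (sum-cong-≗ (cong 𝟙 ∘ lookup∘tabulate neighbour))
  where
  neighbour : VertexSet _
  neighbour u = adj G v u ∧ lookup A u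

module Bootstrap {n : ℕ} (G : Graph n) (t : Fin n → ℕ) (A₀ : Subset n) where

  active : ℕ → VertexSet n
  active i = lookup (stage G t A₀ i)

  over-threshold : ℕ → VertexSet n
  over-threshold i v = t v ≤ᵇ nbrCount G (stage G t A₀ i) v

  active-suc : ∀ i v → active (suc i) v ≡ (active i v ∨ over-threshold i v)
  active-suc i v = lookup∘tabulate (λ v → active i v ∨ over-threshold i v) v

  active-mono : ∀ {i j v} → i ≤ j → active i v ≡ true → active j v ≡ true
  active-mono {j = zero}  z≤n     aᵢ = aᵢ
  active-mono {j = suc j} {v} i≤1+j aᵢ with m≤n⇒m<n∨m≡n i≤1+j
  ... | inj₂ refl  = aᵢ
  ... | inj₁ i<1+j =
    trans (active-suc j v) (cong (_∨ over-threshold j v) (active-mono (s≤s⁻¹ i<1+j) aᵢ))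

  threshold-reached : ∀ {j v} → active j v ≡ false → active (suc j) v ≡ true →
                      t v ≤ nbrCount G (stage G t A₀ j) v
  threshold-reached {j} {v} aⱼ a₁₊ⱼ =
    ≤ᵇ⇒≤ _ _ (≡true⇒T (subst (λ b → (b ∨ over-threshold j v) ≡ true) aⱼ
                               (trans (sym (active-suc j v)) a₁₊ⱼ)))

  activation-step : ∀ I {v} → active 0 v ≡ false → active I v ≡ true →
                    ∃ λ j → j < I × active j v ≡ false × active (suc j) v ≡ true
  activation-step zero    a₀ a₀′ = contradiction (trans (sym a₀) a₀′) λ ()
  activation-step (suc I) {v} a₀ a₁₊ᵢ with active I v in aᵢ
  ... | false = I , ≤-refl , aᵢ , a₁₊ᵢ
  ... | true with j , j<I , rest ← activation-step I a₀ aᵢ = j , m≤n⇒m≤1+n j<I , rest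

  active-at-common-stage : ∀ {L} → All (Activated G t A₀) L →
                           ∃ λ I → All (λ v → active I v ≡ true) L
  active-at-common-stage [] = 0 , []
  active-at-common-stage ((i , v∈Aᵢ) ∷ rest) with I , all ← active-at-common-stage rest =
    i ⊔ I , active-mono (m≤m⊔n i I) ([]=⇒lookup v∈Aᵢ) ∷ All.map (active-mono (m≤n⊔m i I)) all

  -- rank I v is the activation time of v, capped at I.
  rank : ℕ → Fin n → ℕ
  rank I v = sum {I} (λ i → 𝟙 (not (active (toℕ i) v)))

  rank-< : ∀ {I j u v} → j < I → active j u ≡ true → active j v ≡ false → rank I u < rank I v
  rank-< {I} {j} {u} {v} j<I aⱼu aⱼv = sum-mono-< (fromℕ< j<I) (λ i → pointwise (toℕ i)) at-j
    where
    pointwise : ∀ i → 𝟙 (not (active i u)) ≤ 𝟙 (not (active i v))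
    pointwise i with active i u in aᵢu | active i v in aᵢv
    ... | true  | _     = z≤n
    ... | false | false = ≤-refl
    ... | false | true with ≤-total i j
    ...   | inj₁ i≤j = contradiction (trans (sym (active-mono i≤j aᵢv)) aⱼv) λ ()
    ...   | inj₂ j≤i = contradiction (trans (sym (active-mono j≤i aⱼu)) aᵢu) λ ()
    at-j : 𝟙 (not (active (toℕ (fromℕ< j<I)) u)) < 𝟙 (not (active (toℕ (fromℕ< j<I)) v))
    at-j rewrite toℕ-fromℕ< j<I | aⱼu | aⱼv = ≤-refl

  threshold≤indegree : ∀ I {v} → (active I ─ lookup A₀) v ≡ true →
                       t v ≤ Ranked.indegree G (rank I) (active I) v
  threshold≤indegree I {v} new
    with aᵢ , v∉A₀ ← ─-elim (active I) (lookup A₀) new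
    with j , j<I , aⱼ , a₁₊ⱼ ← activation-step I v∉A₀ aᵢ = begin
      t v                                       ≤⟨ threshold-reached {j} aⱼ a₁₊ⱼ ⟩
      nbrCount G (stage G t A₀ j) v             ≡⟨ nbrCount≡size G (stage G t A₀ j) v ⟩
      size (λ u → adj G v u ∧ active j u)       ≤⟨ weight-mono-≤ (λ u → adj G v u ∧ active j u) active-at-I earlier ⟩
      Ranked.indegree G (rank I) (active I) v   ∎
    where
    open ≤-Reasoning
    active-at-I : (λ u → adj G v u ∧ active j u) ⊆ active I
    active-at-I u = active-mono (<⇒≤ j<I) ∘ proj₂ ∘ ∧-true⁻ {adj G v u}
    earlier : ∀ u → (adj G v u ∧ active j u) ≡ true → 1 ≤ 𝟙 (Ranked._⇝_ G (rank I) u v)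
    earlier u vu∧aⱼu with vu , aⱼu ← ∧-true⁻ {adj G v u} vu∧aⱼu
      rewrite Graph.sym G u v | vu | T⇒≡true (<⇒<ᵇ (rank-< j<I aⱼu aⱼ)) = ≤-refl

  new-at-common-stage : ∀ {L} → All (Additional G t A₀) L →
                        ∃ λ I → All (λ v → (active I ─ lookup A₀) v ≡ true) L
  new-at-common-stage additional
    with I , active-L ← active-at-common-stage (All.map proj₁ additional) =
    I , All.zipWith new (active-L , All.map proj₂ additional)
    where
    new : ∀ {v} → active I v ≡ true × v ∉ A₀ → (active I ─ lookup A₀) v ≡ true
    new (aᵢ , v∉A₀) = ─-intro (active I) (lookup A₀) aᵢ (∉⇒lookup≡false v∉A₀)

mainTheorem17 : ∀ (n : ℕ) (G : Graph n) (t : Fin n → ℕ) (A₀ : Subset n) (k : ℕ) →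
    Forest G → (∀ v → 2 ≤ t v) → ∣ A₀ ∣ ≡ k → 1 ≤ k →
    (L : List (Fin n)) → Unique L → All (Additional G t A₀) L → length L < k
mainTheorem17 n G t A₀ k forest 2≤t ∣A₀∣≡k 1≤k L unique additional
  with I , new ← Bootstrap.new-at-common-stage G t A₀ additional = begin-strict
    length L                    ≤⟨ length≤size unique new ⟩
    size (active I ─ seeds)     <⟨ indegree≥2⇒size─<size forest (active I) seeds 2≤indegree 1≤size-seeds ⟩
    size seeds                  ≡⟨ ∣p∣≡size A₀ ⟨
    ∣ A₀ ∣                      ≡⟨ ∣A₀∣≡k ⟩
    k                           ∎
  where
  open Bootstrap G t A₀
  open Ranked G (rank I)
  open ≤-Reasoning
  seeds : VertexSet n
  seeds = lookup A₀
  2≤indegree : ∀ v → (active I ─ seeds) v ≡ true → 2 ≤ indegree (active I) v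
  2≤indegree v v-new = ≤-trans (2≤t v) (threshold≤indegree I v-new)
  1≤size-seeds : 1 ≤ size seeds
  1≤size-seeds = subst (1 ≤_) (trans (sym ∣A₀∣≡k) (∣p∣≡size A₀)) 1≤k
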